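{- Let $\mathcal Q$ be a quantale and $\mathcal S\subseteq\mathcal Q$ a subquantale. Then: (1) $Ia=\bigvee\{q\in\mathcal S\mid q\le a,\ q\in\mathcal Z(\mathcal Q)\}$ is a central quantic conucleus; (2) if $\mathcal Q$ is unital with unit $\varepsilon$, $Ia=\bigvee\{q\in\mathcal S\mid q\le a,\ q\le\varepsilon\}$ is a unital quantic conucleus; (3) $Ia=\bigvee\{q\in\mathcal S\mid q\le a,\ \forall b\in\mathcal Q,\ b\cdot q\vee q\cdot b\le q\cdot b\cdot q\}$ is a strongly square increasing quantic conucleus; (4) for any combination of these conditions on $q$, the operation defined by requiring all chosen conditions is a quantic conucleus having each of the corresponding properties.
   Context: A quantale is a complete join-semilattice with an associative multiplication distributing over arbitrary joins on both sides; unital if it has a unit $\varepsilon$. A subquantale is a subset closed under multiplication and arbitrary joins. $\mathcal Z(\mathcal Q)=\{a\mid\forall b,\ a\cdot b=b\cdot a\}$ is the centre. A quantic conucleus is a map $I$ with $Ia\le a$, $I(Ia)=Ia$, $a\le b\Rightarrow Ia\le Ib$, and $Ia\cdot Ib=I(Ia\cdot Ib)$. A conucleus $I$ is central if $Ia\cdot b=b\cdot Ia$ for all $a,b$; strongly square increasing if $Ia\cdot b\le Ia\cdot b\cdot Ia$ and $b\cdot Ia\le Ia\cdot b\cdot Ia$ for all $a,b$; unital if $Ia\le\varepsilon$ for all $a$. -}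

module Defs where

open import Level using (Level; _⊔_; Lift) renaming (suc to lsuc)
open import Data.Bool using (Bool; true; false)
open import Data.Unit.Polymorphic using (⊤)
open import Data.Product using (Σ; _×_; _,_)
open import Data.Sum using (_⊎_)
open import Relation.Binary.PropositionalEquality using (_≡_)
open import Relation.Binary.Structures using (IsPartialOrder)

record Quantale (c : Level) : Set (lsuc c) where
  infixl 7 _·_
  infix 4 _≤_
  field
    Carrier   : Set c
    _≤_       : Carrier → Carrier → Set c
    isPartialOrder : IsPartialOrder _≡_ _≤_
    ⋁         : (Carrier → Set c) → Carrier
    ⋁-upper   : ∀ (T : Carrier → Set c) x → T x → x ≤ ⋁ T
    ⋁-least   : ∀ (T : Carrier → Set c) y → (∀ x → T x → x ≤ y) → ⋁ T ≤ y
    _·_       : Carrier → Carrier → Carrier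
    ·-assoc   : ∀ a b d → (a · b) · d ≡ a · (b · d)
    ·-distribˡ-⋁ : ∀ a (T : Carrier → Set c) →
                   a · ⋁ T ≡ ⋁ (λ x → Σ Carrier (λ t → T t × x ≡ a · t))
    ·-distribʳ-⋁ : ∀ (T : Carrier → Set c) a →
                   ⋁ T · a ≡ ⋁ (λ x → Σ Carrier (λ t → T t × x ≡ t · a))

  infixl 6 _∨_
  _∨_ : Carrier → Carrier → Carrier
  a ∨ b = ⋁ (λ x → (x ≡ a) ⊎ (x ≡ b))

module _ {c : Level} (Q : Quantale c) where
  open Quantale Q

  record Unit : Set c where
    field
      ε       : Carrier
      ·-identityˡ : ∀ a → ε · a ≡ a
      ·-identityʳ : ∀ a → a · ε ≡ a

  IsSubquantale : (Carrier → Set c) → Set (lsuc c)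
  IsSubquantale S =
    (∀ x y → S x → S y → S (x · y)) ×
    (∀ (T : Carrier → Set c) → (∀ x → T x → S x) → S (⋁ T))

  InCentre : Carrier → Set c
  InCentre a = ∀ b → a · b ≡ b · a

  SSIElt : Carrier → Set c
  SSIElt q = ∀ b → (b · q) ∨ (q · b) ≤ (q · b) · q

  conuc : (S : Carrier → Set c) (P : Carrier → Set c) → Carrier → Carrier
  conuc S P a = ⋁ (λ q → S q × q ≤ a × P q)

  record IsQuanticConucleus (I : Carrier → Carrier) : Set c where
    field
      deflationary : ∀ a → I a ≤ a
      idempotent   : ∀ a → I (I a) ≡ I a
      monotone     : ∀ a b → a ≤ b → I a ≤ I b
      ·-closed     : ∀ a b → I a · I b ≡ I (I a · I b)

  IsCentral : (Carrier → Carrier) → Set c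
  IsCentral I = ∀ a b → I a · b ≡ b · I a

  IsStronglySquareIncreasing : (Carrier → Carrier) → Set c
  IsStronglySquareIncreasing I =
    ∀ a b → (I a · b ≤ (I a · b) · I a) × (b · I a ≤ (I a · b) · I a)

  IsUnitalConucleus : Unit → (Carrier → Carrier) → Set c
  IsUnitalConucleus U I = ∀ a → I a ≤ Unit.ε U

  Opt : Bool → Set c → Set c
  Opt true  A = A
  Opt false A = ⊤

  CondU : Unit → Bool → Bool → Bool → Carrier → Set c
  CondU U cen uni ssi q =
    Opt cen (InCentre q) × Opt uni (q ≤ Unit.ε U) × Opt ssi (SSIElt q)

  Cond : Bool → Bool → Carrier → Set c
  Cond cen ssi q = Opt cen (InCentre q) × Opt ssi (SSIElt q)

-- Each of the three conditions on q (central, below the unit, strongly square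
-- increasing) singles out a subquantale of Q, and so does any conjunction of
-- them. For subquantales S and P, I a is the largest element of S ∩ P below a,
-- which makes I a quantic conucleus; and since I a itself lies in P, every
-- property of the elements of P is inherited by the values of I.
module Submission where

open import Defs
open import Level using (Level)
open import Data.Bool using (Bool; true; false)
open import Data.Product using (Σ; _×_; _,_; proj₁; proj₂)
open import Data.Sum using (inj₁; inj₂)
open import Data.Unit.Polymorphic using (⊤; tt)
open import Relation.Binary.PropositionalEquality using (_≡_; refl; sym; cong; subst)
open import Relation.Binary.Structures using (IsPartialOrder)
open import Relation.Binary.Bundles using (Poset)
import Relation.Binary.Reasoning.PartialOrder as PartialOrderReasoning

Opt-fromTrue : ∀ {c} (Q : Quantale c) b (F : Bool → Set c) → F true → Opt Q b (F b)
Opt-fromTrue Q true  F x = x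
Opt-fromTrue Q false F x = tt

module _ {c : Level} (Q : Quantale c) where
  open Quantale Q
  open IsPartialOrder isPartialOrder using (antisym) renaming (refl to ≤-refl; trans to ≤-trans)

  poset : Poset c c c
  poset = record { isPartialOrder = isPartialOrder }
  open PartialOrderReasoning poset

  Image : (Carrier → Carrier) → (Carrier → Set c) → Carrier → Set c
  Image f T x = Σ Carrier (λ t → T t × x ≡ f t)

  ⋁-image-least : ∀ f T {y} → (∀ t → T t → f t ≤ y) → ⋁ (Image f T) ≤ y
  ⋁-image-least f T h = ⋁-least _ _ λ { _ (t , Tt , refl) → h t Tt }

  ⋁-image-cong : ∀ {f g} T → (∀ t → T t → f t ≡ g t) → ⋁ (Image f T) ≡ ⋁ (Image g T)
  ⋁-image-cong {f} {g} T h = antisym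
    (⋁-image-least f T λ t Tt → subst (_≤ ⋁ (Image g T)) (sym (h t Tt)) (⋁-upper _ _ (t , Tt , refl)))
    (⋁-image-least g T λ t Tt → subst (_≤ ⋁ (Image f T)) (h t Tt) (⋁-upper _ _ (t , Tt , refl)))

  ∨-upperˡ : ∀ a b → a ≤ a ∨ b
  ∨-upperˡ a b = ⋁-upper _ a (inj₁ refl)

  ∨-upperʳ : ∀ a b → b ≤ a ∨ b
  ∨-upperʳ a b = ⋁-upper _ b (inj₂ refl)

  ∨-least : ∀ {a b d} → a ≤ d → b ≤ d → a ∨ b ≤ d
  ∨-least p q = ⋁-least _ _ λ { _ (inj₁ refl) → p ; _ (inj₂ refl) → q }

  ∨-absorbʳ : ∀ {a b} → a ≤ b → a ∨ b ≡ b
  ∨-absorbʳ p = antisym (∨-least p ≤-refl) (∨-upperʳ _ _)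

  -- Monotonicity comes from distributivity over the join a ∨ b = b.
  ·-monoˡ-≤ : ∀ {a b} d → a ≤ b → a · d ≤ b · d
  ·-monoˡ-≤ {a} d p = subst (λ z → a · d ≤ z · d) (∨-absorbʳ p)
    (subst (a · d ≤_) (sym (·-distribʳ-⋁ _ d)) (⋁-upper _ _ (a , inj₁ refl , refl)))

  ·-monoʳ-≤ : ∀ {a b} d → a ≤ b → d · a ≤ d · b
  ·-monoʳ-≤ {a} d p = subst (λ z → d · a ≤ d · z) (∨-absorbʳ p)
    (subst (d · a ≤_) (sym (·-distribˡ-⋁ d _)) (⋁-upper _ _ (a , inj₁ refl , refl)))

  ·-mono-≤ : ∀ {a b a′ b′} → a ≤ a′ → b ≤ b′ → a · b ≤ a′ · b′
  ·-mono-≤ p q = ≤-trans (·-monoˡ-≤ _ p) (·-monoʳ-≤ _ q)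

  ⊤-isSubquantale : IsSubquantale Q (λ _ → ⊤)
  ⊤-isSubquantale = (λ _ _ _ _ → tt) , (λ _ _ → tt)

  ∩-isSubquantale : ∀ {P R} → IsSubquantale Q P → IsSubquantale Q R →
                    IsSubquantale Q (λ q → P q × R q)
  ∩-isSubquantale (P-· , P-⋁) (R-· , R-⋁) =
    (λ x y p r → P-· x y (proj₁ p) (proj₁ r) , R-· x y (proj₂ p) (proj₂ r)) ,
    (λ T h → P-⋁ T (λ x t → proj₁ (h x t)) , R-⋁ T (λ x t → proj₂ (h x t)))

  Opt-isSubquantale : ∀ b {P} → IsSubquantale Q P → IsSubquantale Q (λ q → Opt Q b (P q))
  Opt-isSubquantale true  P-sub = P-sub
  Opt-isSubquantale false P-sub = ⊤-isSubquantale

  centre-isSubquantale : IsSubquantale Q (InCentre Q)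
  centre-isSubquantale = centre-· , centre-⋁
    where
    centre-· : ∀ x y → InCentre Q x → InCentre Q y → InCentre Q (x · y)
    centre-· x y x-central y-central b = begin-equality
      (x · y) · b ≡⟨ ·-assoc x y b ⟩
      x · (y · b) ≡⟨ cong (x ·_) (y-central b) ⟩
      x · (b · y) ≡⟨ sym (·-assoc x b y) ⟩
      (x · b) · y ≡⟨ cong (_· y) (x-central b) ⟩
      (b · x) · y ≡⟨ ·-assoc b x y ⟩
      b · (x · y) ∎
    centre-⋁ : ∀ T → (∀ x → T x → InCentre Q x) → InCentre Q (⋁ T)
    centre-⋁ T central b = begin-equality
      ⋁ T · b                ≡⟨ ·-distribʳ-⋁ T b ⟩
      ⋁ (Image (_· b) T)    ≡⟨ ⋁-image-cong T (λ t Tt → central t Tt b) ⟩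
      ⋁ (Image (b ·_) T)    ≡⟨ sym (·-distribˡ-⋁ b T) ⟩
      b · ⋁ T                ∎

  belowUnit-isSubquantale : (U : Unit Q) → IsSubquantale Q (_≤ Unit.ε U)
  belowUnit-isSubquantale U = below-· , λ T → ⋁-least T ε
    where
    open Unit U
    below-· : ∀ x y → x ≤ ε → y ≤ ε → x · y ≤ ε
    below-· x y x≤ε y≤ε = begin
      x · y ≤⟨ ·-monoˡ-≤ y x≤ε ⟩
      ε · y ≡⟨ ·-identityˡ y ⟩
      y     ≤⟨ y≤ε ⟩
      ε     ∎

  SSIElt-left : ∀ {q} → SSIElt Q q → ∀ b → b · q ≤ (q · b) · q
  SSIElt-left q-ssi b = ≤-trans (∨-upperˡ _ _) (q-ssi b)

  SSIElt-right : ∀ {q} → SSIElt Q q → ∀ b → q · b ≤ (q · b) · q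
  SSIElt-right q-ssi b = ≤-trans (∨-upperʳ _ _) (q-ssi b)

  SSIElt-isSubquantale : IsSubquantale Q (SSIElt Q)
  SSIElt-isSubquantale = SSIElt-· , SSIElt-⋁
    where
    SSIElt-· : ∀ x y → SSIElt Q x → SSIElt Q y → SSIElt Q (x · y)
    SSIElt-· x y x-ssi y-ssi b = ∨-least left right
      where
      regroup : x · ((y · (b · x)) · y) ≡ ((x · y) · b) · (x · y)
      regroup = begin-equality
        x · ((y · (b · x)) · y) ≡⟨ cong (x ·_) (·-assoc y (b · x) y) ⟩
        x · (y · ((b · x) · y)) ≡⟨ sym (·-assoc x y _) ⟩
        (x · y) · ((b · x) · y) ≡⟨ cong ((x · y) ·_) (·-assoc b x y) ⟩
        (x · y) · (b · (x · y)) ≡⟨ sym (·-assoc (x · y) b (x · y)) ⟩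
        ((x · y) · b) · (x · y) ∎
      left : b · (x · y) ≤ ((x · y) · b) · (x · y)
      left = begin
        b · (x · y)             ≡⟨ sym (·-assoc b x y) ⟩
        (b · x) · y             ≤⟨ ·-monoˡ-≤ y (SSIElt-left x-ssi b) ⟩
        ((x · b) · x) · y       ≡⟨ ·-assoc (x · b) x y ⟩
        (x · b) · (x · y)       ≡⟨ ·-assoc x b (x · y) ⟩
        x · (b · (x · y))       ≡⟨ cong (x ·_) (sym (·-assoc b x y)) ⟩
        x · ((b · x) · y)       ≤⟨ ·-monoʳ-≤ x (SSIElt-left y-ssi (b · x)) ⟩
        x · ((y · (b · x)) · y) ≡⟨ regroup ⟩
        ((x · y) · b) · (x · y) ∎
      right : (x · y) · b ≤ ((x · y) · b) · (x · y)
      right = begin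
        (x · y) · b             ≡⟨ ·-assoc x y b ⟩
        x · (y · b)             ≤⟨ SSIElt-right x-ssi (y · b) ⟩
        (x · (y · b)) · x       ≡⟨ cong (_· x) (sym (·-assoc x y b)) ⟩
        ((x · y) · b) · x       ≡⟨ ·-assoc (x · y) b x ⟩
        (x · y) · (b · x)       ≡⟨ ·-assoc x y (b · x) ⟩
        x · (y · (b · x))       ≤⟨ ·-monoʳ-≤ x (SSIElt-right y-ssi (b · x)) ⟩
        x · ((y · (b · x)) · y) ≡⟨ regroup ⟩
        ((x · y) · b) · (x · y) ∎
    SSIElt-⋁ : ∀ T → (∀ x → T x → SSIElt Q x) → SSIElt Q (⋁ T)
    SSIElt-⋁ T ssi b = ∨-least
      (subst (_≤ (⋁ T · b) · ⋁ T) (sym (·-distribˡ-⋁ b T))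
        (⋁-image-least (b ·_) T λ t Tt → ≤-trans (SSIElt-left (ssi t Tt) b) (enlarge Tt)))
      (subst (_≤ (⋁ T · b) · ⋁ T) (sym (·-distribʳ-⋁ T b))
        (⋁-image-least (_· b) T λ t Tt → ≤-trans (SSIElt-right (ssi t Tt) b) (enlarge Tt)))
      where
      enlarge : ∀ {t} → T t → (t · b) · t ≤ (⋁ T · b) · ⋁ T
      enlarge Tt = ·-mono-≤ (·-monoˡ-≤ b (⋁-upper T _ Tt)) (⋁-upper T _ Tt)

  module _ {S P : Carrier → Set c} (S-sub : IsSubquantale Q S) (P-sub : IsSubquantale Q P) where
    private
      I = conuc Q S P

    conuc-∈S : ∀ a → S (I a)
    conuc-∈S a = proj₂ S-sub _ (λ _ → proj₁)

    conuc-∈P : ∀ a → P (I a)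
    conuc-∈P a = proj₂ P-sub _ (λ _ h → proj₂ (proj₂ h))

    conuc-greatest : ∀ {x a} → S x → x ≤ a → P x → x ≤ I a
    conuc-greatest s x≤a p = ⋁-upper _ _ (s , x≤a , p)

    conuc-deflationary : ∀ a → I a ≤ a
    conuc-deflationary a = ⋁-least _ a (λ _ h → proj₁ (proj₂ h))

    conuc-isQuanticConucleus : IsQuanticConucleus Q I
    conuc-isQuanticConucleus = record
      { deflationary = conuc-deflationary
      ; idempotent   = λ a → antisym (conuc-deflationary (I a))
                                     (conuc-greatest (conuc-∈S a) ≤-refl (conuc-∈P a))
      ; monotone     = λ a b a≤b → ⋁-least _ (I b) λ _ (s , x≤a , p) →
                                     conuc-greatest s (≤-trans x≤a a≤b) p
      ; ·-closed     = λ a b → antisym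
          (conuc-greatest (proj₁ S-sub _ _ (conuc-∈S a) (conuc-∈S b)) ≤-refl
                          (proj₁ P-sub _ _ (conuc-∈P a) (conuc-∈P b)))
          (conuc-deflationary _)
      }

    conuc-isCentral : (∀ q → P q → InCentre Q q) → IsCentral Q I
    conuc-isCentral central a = central _ (conuc-∈P a)

    conuc-isUnital : (U : Unit Q) → (∀ q → P q → q ≤ Unit.ε U) → IsUnitalConucleus Q U I
    conuc-isUnital U below a = below _ (conuc-∈P a)

    conuc-isStronglySquareIncreasing : (∀ q → P q → SSIElt Q q) → IsStronglySquareIncreasing Q I
    conuc-isStronglySquareIncreasing ssi a b =
      SSIElt-right (ssi _ (conuc-∈P a)) b , SSIElt-left (ssi _ (conuc-∈P a)) b

  Cond-isSubquantale : ∀ cen ssi → IsSubquantale Q (Cond Q cen ssi)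
  Cond-isSubquantale cen ssi =
    ∩-isSubquantale (Opt-isSubquantale cen centre-isSubquantale)
                    (Opt-isSubquantale ssi SSIElt-isSubquantale)

  CondU-isSubquantale : ∀ U cen uni ssi → IsSubquantale Q (CondU Q U cen uni ssi)
  CondU-isSubquantale U cen uni ssi =
    ∩-isSubquantale (Opt-isSubquantale cen centre-isSubquantale)
      (∩-isSubquantale (Opt-isSubquantale uni (belowUnit-isSubquantale U))
                       (Opt-isSubquantale ssi SSIElt-isSubquantale))

mainTheorem15 : ∀ {c : Level} (Q : Quantale c) (S : Quantale.Carrier Q → Set c) →
  IsSubquantale Q S →
  -- (1)
  (IsQuanticConucleus Q (conuc Q S (InCentre Q))
    × IsCentral Q (conuc Q S (InCentre Q)))
  -- (2)
  × ((U : Unit Q) →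
      IsQuanticConucleus Q (conuc Q S (λ q → Quantale._≤_ Q q (Unit.ε U)))
      × IsUnitalConucleus Q U (conuc Q S (λ q → Quantale._≤_ Q q (Unit.ε U))))
  -- (3)
  × (IsQuanticConucleus Q (conuc Q S (SSIElt Q))
    × IsStronglySquareIncreasing Q (conuc Q S (SSIElt Q)))
  -- (4), combinations not involving the unit (any quantale)
  × (∀ (cen ssi : Bool) →
      IsQuanticConucleus Q (conuc Q S (Cond Q cen ssi))
      × Opt Q cen (IsCentral Q (conuc Q S (Cond Q cen ssi)))
      × Opt Q ssi (IsStronglySquareIncreasing Q (conuc Q S (Cond Q cen ssi))))
  -- (4), all combinations, for a unital quantale
  × ((U : Unit Q) → ∀ (cen uni ssi : Bool) →
      IsQuanticConucleus Q (conuc Q S (CondU Q U cen uni ssi))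
      × Opt Q cen (IsCentral Q (conuc Q S (CondU Q U cen uni ssi)))
      × Opt Q uni (IsUnitalConucleus Q U (conuc Q S (CondU Q U cen uni ssi)))
      × Opt Q ssi (IsStronglySquareIncreasing Q (conuc Q S (CondU Q U cen uni ssi))))
mainTheorem15 Q S S-sub =
    ( conuc-isQuanticConucleus Q S-sub (centre-isSubquantale Q)
    , conuc-isCentral Q S-sub (centre-isSubquantale Q) (λ _ p → p) )
  , (λ U → conuc-isQuanticConucleus Q S-sub (belowUnit-isSubquantale Q U)
         , conuc-isUnital Q S-sub (belowUnit-isSubquantale Q U) U (λ _ p → p))
  , ( conuc-isQuanticConucleus Q S-sub (SSIElt-isSubquantale Q)
    , conuc-isStronglySquareIncreasing Q S-sub (SSIElt-isSubquantale Q) (λ _ p → p) )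
  , (λ cen ssi →
        conuc-isQuanticConucleus Q S-sub (Cond-isSubquantale Q cen ssi)
      , Opt-fromTrue Q cen (λ cen → IsCentral Q (conuc Q S (Cond Q cen ssi)))
          (conuc-isCentral Q S-sub (Cond-isSubquantale Q true ssi) (λ _ → proj₁))
      , Opt-fromTrue Q ssi (λ ssi → IsStronglySquareIncreasing Q (conuc Q S (Cond Q cen ssi)))
          (conuc-isStronglySquareIncreasing Q S-sub (Cond-isSubquantale Q cen true) (λ _ → proj₂)))
  , (λ U cen uni ssi →
        conuc-isQuanticConucleus Q S-sub (CondU-isSubquantale Q U cen uni ssi)
      , Opt-fromTrue Q cen (λ cen → IsCentral Q (conuc Q S (CondU Q U cen uni ssi)))
          (conuc-isCentral Q S-sub (CondU-isSubquantale Q U true uni ssi) (λ _ → proj₁))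
      , Opt-fromTrue Q uni (λ uni → IsUnitalConucleus Q U (conuc Q S (CondU Q U cen uni ssi)))
          (conuc-isUnital Q S-sub (CondU-isSubquantale Q U cen true ssi) U (λ _ p → proj₁ (proj₂ p)))
      , Opt-fromTrue Q ssi (λ ssi → IsStronglySquareIncreasing Q (conuc Q S (CondU Q U cen uni ssi)))
          (conuc-isStronglySquareIncreasing Q S-sub (CondU-isSubquantale Q U cen uni true)
            (λ _ p → proj₂ (proj₂ p))))
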